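{- Let $n,m$ be integers with $n\geq m\geq 0$, and let $k\geq 4$. Then $$ gr_{k}(K_{3} : S(n,m)) \geq \begin{cases} 5\cdot\frac{n}{2} + m(k-3)+1 & \text{ if $n$ is even,}\\ 5\cdot\frac{n-1}{2} + m(k-3)+ 2 & \text{ if $n$ is odd.} \end{cases} $$
   Context: For integers $n\geq m\geq 0$, the double star $S(n,m)$ is the graph obtained from the disjoint union of the stars $K_{1,n}$ and $K_{1,m}$ by adding an edge between their centers. A coloring of a graph is rainbow if no two edges receive the same color. For a positive integer $k$ and a graph $H$, the Gallai-Ramsey number $gr_k(K_3 : H)$ is the minimum integer $N$ such that every coloring of the edges of the complete graph $K_N$ with (at most) $k$ colors contains either a rainbow triangle or a monochromatic copy of $H$. -}

module Defs where

open import Data.Nat using (ℕ; zero; suc; _+_; _*_; _∸_; _≤_)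
open import Data.Nat.DivMod using (_/_; _%_)
open import Data.Fin using (Fin; zero; suc; _↑ˡ_; _↑ʳ_)
open import Data.Product using (Σ; ∃; _×_; _,_)
open import Data.Sum using (_⊎_)
open import Relation.Binary.PropositionalEquality using (_≡_; _≢_)
open import Function.Definitions using (Injective)

-- An edge colouring of K_N with (at most) k colours: a symmetric map on
-- pairs of vertices (values on the diagonal are irrelevant).
Coloring : ℕ → ℕ → Set
Coloring N k = Fin N → Fin N → Fin k

SymmetricColoring : ∀ {N k} → Coloring N k → Set
SymmetricColoring {N} c = ∀ (x y : Fin N) → c x y ≡ c y x

RainbowTriangle : ∀ {N k} → Coloring N k → Set
RainbowTriangle {N} c =
  Σ (Fin N) λ x → Σ (Fin N) λ y → Σ (Fin N) λ z →
    (x ≢ y) × (y ≢ z) × (x ≢ z) ×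
    (c x y ≢ c y z) × (c y z ≢ c x z) × (c x y ≢ c x z)

-- The double star S(n,m) on vertex set Fin (2 + (n + m)):
-- vertex 0 is the centre of K_{1,n}, vertex 1 the centre of K_{1,m},
-- vertices 2 + (i ↑ˡ m) (i : Fin n) are the leaves of the first centre,
-- vertices 2 + (n ↑ʳ j) (j : Fin m) are the leaves of the second centre.
data DSEdge (n m : ℕ) : Fin (suc (suc (n + m))) → Fin (suc (suc (n + m))) → Set where
  centres : DSEdge n m zero (suc zero)
  leaf₁   : (i : Fin n) → DSEdge n m zero (suc (suc (i ↑ˡ m)))
  leaf₂   : (j : Fin m) → DSEdge n m (suc zero) (suc (suc (n ↑ʳ j)))

MonoDoubleStar : ∀ {N k} → ℕ → ℕ → Coloring N k → Set
MonoDoubleStar {N} {k} n m c =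
  Σ (Fin k) λ col → Σ (Fin (suc (suc (n + m))) → Fin N) λ φ →
    Injective _≡_ _≡_ φ ×
    (∀ x y → DSEdge n m x y → c (φ x) (φ y) ≡ col)

-- N has the Gallai–Ramsey property for (K_3 : S(n,m)) with k colours:
-- every k-colouring of K_N has a rainbow triangle or a monochromatic S(n,m).
-- gr_k(K_3 : S(n,m)) is the least such N.
GRProperty : ℕ → ℕ → ℕ → ℕ → Set
GRProperty k n m N =
  (c : Coloring N k) → SymmetricColoring c → RainbowTriangle c ⊎ MonoDoubleStar n m c

lowerBound : ℕ → ℕ → ℕ → ℕ
lowerBound n m k with n % 2
... | zero = 5 * (n / 2) + m * (k ∸ 3) + 1
... | suc _ = 5 * ((n ∸ 1) / 2) + m * (k ∸ 3) + 2

module Submission where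

-- We exhibit, for K = k - 3, a colouring of the complete graph on
-- 5⌊n/2⌋ + (n mod 2) + mK vertices with 3 + K colours, with no rainbow
-- triangle and no monochromatic S(n,m); every N below the bound embeds into it.
--
--  * Base: blow up the 2-coloured pentagon (edges coloured by circular
--    distance, diagonal coloured 0) into five blocks of size ⌊n/2⌋, block 0
--    enlarged by n mod 2.  Each colour class at a vertex meets at most two
--    blocks, so every monochromatic neighbourhood has at most n vertices.
--  * Extension: add a block of m new vertices joined to all old ones in a
--    fresh colour.  Repeating this K times uses K new colours.
--  * The invariant kept along the way ('SparseGallaiColouring') is: no rainbow
--    triangle, and for every vertex v and colour c either v has at most n
--    c-neighbours, or each c-neighbour of v has at most m c-neighbours.  By
--    pigeonhole (lemma 'atMost-injection') this forbids a monochromatic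
--    S(n,m), whose centres have n + 1 and m + 1 neighbours in its colour.

open import Defs
open import Data.Nat using (ℕ; zero; suc; _+_; _*_; _∸_; _≤_; z≤n; s≤s)
open import Data.Nat.Properties
  using (≤-refl; ≤-trans; ≤-reflexive; ≤-pred; +-mono-≤; +-monoˡ-≤; *-monoʳ-≤; m≤m+n; m≤n+m; m∸n≤m; +-assoc; ≮⇒≥; 1+n≰n; module ≤-Reasoning)
open import Data.Nat.DivMod using (_/_; _%_; _mod_; m≡m%n+[m/n]*n; /-mono-≤)
open import Data.Nat.Tactic.RingSolver using (solve-∀)
open import Data.Fin using (Fin; zero; suc; toℕ; splitAt; _↑ˡ_; _↑ʳ_)
open import Data.Fin.Patterns using (0F; 1F; 2F; 3F; 4F)
open import Data.Fin.Properties
  using (_≟_; all?; injective⇒≤; splitAt-↑ˡ; splitAt-↑ʳ; ↑ˡ-injective; ↑ʳ-injective; suc-injective; inject≤-injective; +↔⊎; *↔×)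
open import Data.Product using (∃; _×_; _,_; proj₁; proj₂)
open import Data.Sum using (_⊎_; inj₁; inj₂; [_,_])
open import Data.Sum.Function.Propositional using (_⊎-↔_)
open import Data.Empty using (⊥)
open import Function using (_∘_; id)
open import Function.Bundles using (_↣_; _↔_; Injection; mk↣)
open import Function.Construct.Composition using (_↣-∘_; _↔-∘_)
open import Function.Properties.Inverse using (↔-refl; ↔⇒↣)
open import Function.Definitions using (Injective)
open import Relation.Nullary using (¬_; yes; no)
open import Relation.Nullary.Decidable using (_⊎-dec_; toWitness)
open import Relation.Binary.PropositionalEquality
  using (_≡_; _≢_; refl; sym; trans; cong; module ≡-Reasoning)

record AtMost {V : Set} (b : ℕ) (P : V → Set) : Set where
  constructor covering
  field
    size   : ℕ
    size≤  : size ≤ b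
    enum   : Fin size → V
    covers : ∀ w → P w → ∃ λ t → enum t ≡ w

InRange : {V : Set} {d : ℕ} → (Fin d → V) → V → Set
InRange f w = ∃ λ t → f t ≡ w

range-atMost : {V : Set} {d : ℕ} (f : Fin d → V) → AtMost d (InRange f)
range-atMost {d = d} f = covering d ≤-refl f λ _ p → p

atMost-weaken : {V : Set} {P : V → Set} {b b′ : ℕ} → b ≤ b′ → AtMost b P → AtMost b′ P
atMost-weaken b≤b′ (covering s s≤b enum covers) = covering s (≤-trans s≤b b≤b′) enum covers

atMost-⊆ : {V : Set} {P Q : V → Set} {b : ℕ} → (∀ w → Q w → P w) → AtMost b P → AtMost b Q
atMost-⊆ Q⊆P (covering s s≤b enum covers) = covering s s≤b enum λ w q → covers w (Q⊆P w q)

atMost-∪ : {V : Set} {P Q : V → Set} {b b′ : ℕ} →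
           AtMost b P → AtMost b′ Q → AtMost (b + b′) (λ w → P w ⊎ Q w)
atMost-∪ (covering s s≤b e cov) (covering s′ s′≤b′ e′ cov′) =
  covering (s + s′) (+-mono-≤ s≤b s′≤b′) ([ e , e′ ] ∘ splitAt s) covers
  where
    covers : ∀ w → _ ⊎ _ → ∃ λ t → [ e , e′ ] (splitAt s t) ≡ w
    covers w (inj₁ p) with cov w p
    ... | t , et = t ↑ˡ s′ , trans (cong [ e , e′ ] (splitAt-↑ˡ s t s′)) et
    covers w (inj₂ q) with cov′ w q
    ... | t , et = s ↑ʳ t , trans (cong [ e , e′ ] (splitAt-↑ʳ s s′ t)) et

atMost-image : {A B : Set} {P : A → Set} {b : ℕ} (f : A → B) →
               AtMost b P → AtMost b (λ y → ∃ λ x → P x × f x ≡ y)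
atMost-image {P = P} f (covering s s≤b enum covers) = covering s s≤b (f ∘ enum) image-covers
  where
    image-covers : ∀ y → (∃ λ x → P x × f x ≡ y) → ∃ λ t → f (enum t) ≡ y
    image-covers _ (x , px , refl) with covers x px
    ... | t , refl = t , refl

atMost-injection : {V : Set} {P : V → Set} {b d : ℕ} → AtMost b P →
                   (f : Fin d → V) → Injective _≡_ _≡_ f → (∀ i → P (f i)) → d ≤ b
atMost-injection (covering s s≤b enum covers) f f-inj f∈P = ≤-trans (injective⇒≤ index-inj) s≤b
  where
    index : _ → Fin s
    index i = proj₁ (covers (f i) (f∈P i))

    index-inj : Injective _≡_ _≡_ index
    index-inj {i} {j} eq = f-inj (begin
      f i             ≡⟨ sym (proj₂ (covers (f i) (f∈P i))) ⟩
      enum (index i)  ≡⟨ cong enum eq ⟩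
      enum (index j)  ≡⟨ proj₂ (covers (f j) (f∈P j)) ⟩
      f j             ∎)
      where open ≡-Reasoning

-- A k-colouring of the complete graph on V (loops included) without rainbow
-- triangles, even degenerate ones, in which the neighbourhoods in each colour
-- are too small to carry a monochromatic S(n,m).
record SparseGallaiColouring (k n m : ℕ) (V : Set) : Set where
  field
    colour    : V → V → Fin k
    symmetric : ∀ x y → colour x y ≡ colour y x
    gallai    : ∀ x y z → colour x y ≡ colour y z ⊎ colour y z ≡ colour x z ⊎ colour x y ≡ colour x z
    sparse    : ∀ v c → AtMost n (λ w → colour v w ≡ c)
                      ⊎ (∀ w → colour v w ≡ c → AtMost m (λ u → colour w u ≡ c))

centre₁-neighbour : ∀ {n m} → Fin (suc n) → Fin (suc (suc (n + m)))
centre₁-neighbour zero    = suc zero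
centre₁-neighbour {m = m} (suc i) = suc (suc (i ↑ˡ m))

centre₁-neighbour-inj : ∀ {n m} → Injective _≡_ _≡_ (centre₁-neighbour {n} {m})
centre₁-neighbour-inj {x = zero}  {zero}  _  = refl
centre₁-neighbour-inj {m = m} {x = suc i} {suc j} eq =
  cong suc (↑ˡ-injective m i j (suc-injective (suc-injective eq)))

centre₁-edge : ∀ {n m} (i : Fin (suc n)) → DSEdge n m zero (centre₁-neighbour {n} {m} i)
centre₁-edge zero    = centres
centre₁-edge (suc i) = leaf₁ i

centre₂-neighbour : ∀ {n m} → Fin (suc m) → Fin (suc (suc (n + m)))
centre₂-neighbour zero    = zero
centre₂-neighbour {n = n} (suc j) = suc (suc (n ↑ʳ j))

centre₂-neighbour-inj : ∀ {n m} → Injective _≡_ _≡_ (centre₂-neighbour {n} {m})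
centre₂-neighbour-inj {x = zero}  {zero}  _  = refl
centre₂-neighbour-inj {n = n} {x = suc i} {suc j} eq =
  cong suc (↑ʳ-injective n i j (suc-injective (suc-injective eq)))

module _ {k n m : ℕ} {V : Set} (G : SparseGallaiColouring k n m V) where
  open SparseGallaiColouring G

  -- No monochromatic S(n,m): if the first centre has at most n neighbours in
  -- the colour, its n + 1 neighbours collide; otherwise the second centre has
  -- at most m, and its m + 1 neighbours collide.
  no-mono-double-star : (col : Fin k) (φ : Fin (suc (suc (n + m))) → V) → Injective _≡_ _≡_ φ →
                        (∀ x y → DSEdge n m x y → colour (φ x) (φ y) ≡ col) → ⊥
  no-mono-double-star col φ φ-inj mono with sparse (φ zero) col
  ... | inj₁ few = 1+n≰n (atMost-injection few (φ ∘ centre₁-neighbour {n} {m})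
                           (centre₁-neighbour-inj {n} {m} ∘ φ-inj) λ i → mono _ _ (centre₁-edge i))
  ... | inj₂ fewAtNeighbours = 1+n≰n (atMost-injection (fewAtNeighbours (φ 1F) (mono _ _ centres))
                                 (φ ∘ centre₂-neighbour {n} {m}) (centre₂-neighbour-inj {n} {m} ∘ φ-inj) centre₂-edge)
    where
      centre₂-edge : ∀ j → colour (φ 1F) (φ (centre₂-neighbour {n} {m} j)) ≡ col
      centre₂-edge zero    = trans (symmetric (φ 1F) (φ 0F)) (mono _ _ centres)
      centre₂-edge (suc j) = mono _ _ (leaf₂ j)

  refutes-GRProperty : {N : ℕ} → Fin N ↣ V → ¬ GRProperty k n m N
  refutes-GRProperty ι gr = [ no-rainbow , no-mono ] (gr restricted (λ x y → symmetric (to x) (to y)))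
    where
      open Injection ι

      restricted : Coloring _ k
      restricted x y = colour (to x) (to y)

      no-rainbow : ¬ RainbowTriangle restricted
      no-rainbow (x , y , z , _ , _ , _ , xy≢yz , yz≢xz , xy≢xz) =
        [ xy≢yz , [ yz≢xz , xy≢xz ] ] (gallai (to x) (to y) (to z))

      no-mono : ¬ MonoDoubleStar n m restricted
      no-mono (col , φ , φ-inj , mono) = no-mono-double-star col (to ∘ φ) (φ-inj ∘ injective) mono

_⊕_ : Fin 5 → ℕ → Fin 5
i ⊕ d = (toℕ i + d) mod 5

pentagon : Fin 5 → Fin 5 → Fin 3
pentagon i j = distance ((toℕ j + 5 ∸ toℕ i) mod 5)
  where
    distance : Fin 5 → Fin 3
    distance 0F = 0F
    distance 1F = 1F
    distance 2F = 2F
    distance 3F = 2F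
    distance 4F = 1F

pentagon-symmetric : ∀ i j → pentagon i j ≡ pentagon j i
pentagon-symmetric = toWitness {a? = all? λ i → all? λ j → pentagon i j ≟ pentagon j i} _

-- No rainbow triangle: off the diagonal only the two colours 1 and 2 occur.
pentagon-gallai : ∀ i j l → pentagon i j ≡ pentagon j l ⊎ pentagon j l ≡ pentagon i l ⊎ pentagon i j ≡ pentagon i l
pentagon-gallai = toWitness {a? = all? λ i → all? λ j → all? λ l →
  (pentagon i j ≟ pentagon j l) ⊎-dec ((pentagon j l ≟ pentagon i l) ⊎-dec (pentagon i j ≟ pentagon i l))} _

pentagon-neighbours : ∀ i j → j ≡ i ⊕ toℕ (pentagon i j) ⊎ j ≡ i ⊕ (5 ∸ toℕ (pentagon i j))
pentagon-neighbours = toWitness {a? = all? λ i → all? λ j →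
  (j ≟ i ⊕ toℕ (pentagon i j)) ⊎-dec (j ≟ i ⊕ (5 ∸ toℕ (pentagon i j)))} _

module BlowUp (a r : ℕ) where

  Vertex : Set
  Vertex = Fin 5 × Fin a ⊎ Fin r

  block : Vertex → Fin 5
  block (inj₁ (i , _)) = i
  block (inj₂ _)       = 0F

  blockSize : Fin 5 → ℕ
  blockSize zero    = a + r
  blockSize (suc _) = a

  block-atMost : ∀ j → AtMost (blockSize j) (λ w → block w ≡ j)
  block-atMost zero    = atMost-⊆ inBlock₀ (atMost-∪ (range-atMost (λ u → inj₁ (0F , u))) (range-atMost inj₂))
    where
      inBlock₀ : ∀ w → block w ≡ 0F → InRange (λ u → inj₁ (0F , u)) w ⊎ InRange inj₂ w
      inBlock₀ (inj₁ (zero , u)) refl = inj₁ (u , refl)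
      inBlock₀ (inj₂ u)          refl = inj₂ (u , refl)
  block-atMost (suc j) = atMost-⊆ inBlock (range-atMost (λ u → inj₁ (suc j , u)))
    where
      inBlock : ∀ w → block w ≡ suc j → InRange (λ u → inj₁ (suc j , u)) w
      inBlock (inj₁ (suc j , u)) refl = u , refl

  enumeration : Fin (5 * a + r) ↔ Vertex
  enumeration = (*↔× ⊎-↔ ↔-refl) ↔-∘ +↔⊎

  module _ {n : ℕ} (fits : a + a + r ≤ n) where

    blockSize≤ : ∀ j → blockSize j ≤ n
    blockSize≤ zero    = ≤-trans (+-monoˡ-≤ r (m≤n+m a a)) fits
    blockSize≤ (suc _) = ≤-trans (≤-trans (m≤m+n a a) (m≤m+n (a + a) r)) fits

    pairSize≤ : ∀ {j j′} → j ≢ j′ → blockSize j + blockSize j′ ≤ n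
    pairSize≤ {zero}  {zero}  j≢j′ with () ← j≢j′ refl
    pairSize≤ {zero}  {suc _} _ = ≤-trans (≤-reflexive (swap a r a)) fits
      where swap : ∀ x y z → x + y + z ≡ x + z + y
            swap = solve-∀
    pairSize≤ {suc _} {zero}  _ = ≤-trans (≤-reflexive (sym (+-assoc a a r))) fits
    pairSize≤ {suc _} {suc _} _ = ≤-trans (m≤m+n (a + a) r) fits

    two-blocks-atMost : ∀ j j′ → AtMost n (λ w → block w ≡ j ⊎ block w ≡ j′)
    two-blocks-atMost j j′ with j ≟ j′
    ... | yes refl = atMost-⊆ (λ _ → [ id , id ]) (atMost-weaken (blockSize≤ j) (block-atMost j))
    ... | no j≢j′  = atMost-weaken (pairSize≤ j≢j′) (atMost-∪ (block-atMost j) (block-atMost j′))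

    colouring : (m : ℕ) → SparseGallaiColouring 3 n m Vertex
    colouring m = record
      { colour    = λ x y → pentagon (block x) (block y)
      ; symmetric = λ x y → pentagon-symmetric (block x) (block y)
      ; gallai    = λ x y z → pentagon-gallai (block x) (block y) (block z)
      ; sparse    = λ v c → inj₁ (atMost-⊆ (neighbourhood v c)
                      (two-blocks-atMost (block v ⊕ toℕ c) (block v ⊕ (5 ∸ toℕ c))))
      }
      where
        neighbourhood : ∀ v c w → pentagon (block v) (block w) ≡ c →
                        block w ≡ block v ⊕ toℕ c ⊎ block w ≡ block v ⊕ (5 ∸ toℕ c)
        neighbourhood v c w refl = pentagon-neighbours (block v) (block w)

module _ {k n m : ℕ} {V : Set} (G : SparseGallaiColouring k n m V) (m≤n : m ≤ n) (inner : Fin k) where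
  open SparseGallaiColouring G

  extendedColour : V ⊎ Fin m → V ⊎ Fin m → Fin (suc k)
  extendedColour (inj₁ x) (inj₁ y) = suc (colour x y)
  extendedColour (inj₁ _) (inj₂ _) = zero
  extendedColour (inj₂ _) (inj₁ _) = zero
  extendedColour (inj₂ _) (inj₂ _) = suc inner

  extended-symmetric : ∀ x y → extendedColour x y ≡ extendedColour y x
  extended-symmetric (inj₁ x) (inj₁ y) = cong suc (symmetric x y)
  extended-symmetric (inj₁ _) (inj₂ _) = refl
  extended-symmetric (inj₂ _) (inj₁ _) = refl
  extended-symmetric (inj₂ _) (inj₂ _) = refl

  -- A triangle meeting both parts has two edges of the fresh colour; a
  -- triangle inside one part is not rainbow there.
  extended-gallai : ∀ x y z → extendedColour x y ≡ extendedColour y z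
                             ⊎ extendedColour y z ≡ extendedColour x z
                             ⊎ extendedColour x y ≡ extendedColour x z
  extended-gallai (inj₁ x) (inj₁ y) (inj₁ z) with gallai x y z
  ... | inj₁ eq        = inj₁ (cong suc eq)
  ... | inj₂ (inj₁ eq) = inj₂ (inj₁ (cong suc eq))
  ... | inj₂ (inj₂ eq) = inj₂ (inj₂ (cong suc eq))
  extended-gallai (inj₁ _) (inj₁ _) (inj₂ _) = inj₂ (inj₁ refl)
  extended-gallai (inj₁ _) (inj₂ _) (inj₁ _) = inj₁ refl
  extended-gallai (inj₁ _) (inj₂ _) (inj₂ _) = inj₂ (inj₂ refl)
  extended-gallai (inj₂ _) (inj₁ _) (inj₁ _) = inj₂ (inj₂ refl)
  extended-gallai (inj₂ _) (inj₁ _) (inj₂ _) = inj₁ refl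
  extended-gallai (inj₂ _) (inj₂ _) (inj₁ _) = inj₂ (inj₁ refl)
  extended-gallai (inj₂ _) (inj₂ _) (inj₂ _) = inj₁ refl

  new-block-atMost : {P : V ⊎ Fin m → Set} → (∀ w → P w → InRange inj₂ w) → AtMost m P
  new-block-atMost P⊆new = atMost-⊆ P⊆new (range-atMost inj₂)

  lift-atMost : ∀ {b x c} → AtMost b (λ y → colour x y ≡ c) →
                AtMost b (λ w → extendedColour (inj₁ x) w ≡ suc c)
  lift-atMost {x = x} {c} few = atMost-⊆ old (atMost-image inj₁ few)
    where
      old : ∀ w → extendedColour (inj₁ x) w ≡ suc c → ∃ λ y → colour x y ≡ c × inj₁ y ≡ w
      old (inj₁ y) eq = y , suc-injective eq , refl

  -- New vertex, fresh colour: its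
  -- neighbours are old and see only the m new vertices.
  extended-sparse : ∀ v c → AtMost n (λ w → extendedColour v w ≡ c)
                          ⊎ (∀ w → extendedColour v w ≡ c → AtMost m (λ u → extendedColour w u ≡ c))
  extended-sparse (inj₁ x) zero = inj₁ (atMost-weaken m≤n (new-block-atMost new))
    where new : ∀ w → extendedColour (inj₁ x) w ≡ zero → InRange inj₂ w
          new (inj₂ u) _ = u , refl
  extended-sparse (inj₁ x) (suc c) with sparse x c
  ... | inj₁ few = inj₁ (lift-atMost few)
  ... | inj₂ fewAtNeighbours = inj₂ λ { (inj₁ y) eq → lift-atMost (fewAtNeighbours y (suc-injective eq)) }
  extended-sparse (inj₂ _) zero = inj₂ λ { (inj₁ y) _ → new-block-atMost (new y) }
    where new : ∀ y w → extendedColour (inj₁ y) w ≡ zero → InRange inj₂ w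
          new _ (inj₂ u) _ = u , refl
  extended-sparse (inj₂ u) (suc c) = inj₁ (atMost-weaken m≤n (new-block-atMost new))
    where new : ∀ w → extendedColour (inj₂ u) w ≡ suc c → InRange inj₂ w
          new (inj₂ u) _ = u , refl

  extend : SparseGallaiColouring (suc k) n m (V ⊎ Fin m)
  extend = record
    { colour    = extendedColour
    ; symmetric = extended-symmetric
    ; gallai    = extended-gallai
    ; sparse    = extended-sparse
    }

module Construction (n m : ℕ) (m≤n : m ≤ n) where
  open BlowUp (n / 2) (n % 2)

  halves : n / 2 + n / 2 + n % 2 ≡ n
  halves = trans (rearrange (n / 2) (n % 2)) (sym (m≡m%n+[m/n]*n n 2))
    where rearrange : ∀ a r → a + a + r ≡ r + a * 2
          rearrange = solve-∀

  Layers : ℕ → Set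
  Layers zero    = Vertex
  Layers (suc K) = Layers K ⊎ Fin m

  layered : ∀ K → SparseGallaiColouring (3 + K) n m (Layers K)
  layered zero    = colouring (≤-reflexive halves) m
  layered (suc K) = extend (layered K) m≤n zero

  vertices : ℕ → ℕ
  vertices zero    = 5 * (n / 2) + n % 2
  vertices (suc K) = vertices K + m

  layers-enumeration : ∀ K → Fin (vertices K) ↔ Layers K
  layers-enumeration zero    = enumeration
  layers-enumeration (suc K) = (layers-enumeration K ⊎-↔ ↔-refl) ↔-∘ +↔⊎

  vertices≡ : ∀ K → vertices K ≡ 5 * (n / 2) + n % 2 + m * K
  vertices≡ zero    = no-layers (5 * (n / 2) + n % 2) m
    where no-layers : ∀ x y → x ≡ x + y * 0
          no-layers = solve-∀
  vertices≡ (suc K) = begin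
    vertices K + m                             ≡⟨ cong (_+ m) (vertices≡ K) ⟩
    5 * (n / 2) + n % 2 + m * K + m            ≡⟨ +-assoc (5 * (n / 2) + n % 2) (m * K) m ⟩
    5 * (n / 2) + n % 2 + (m * K + m)          ≡⟨ cong (5 * (n / 2) + n % 2 +_) (step m K) ⟩
    5 * (n / 2) + n % 2 + m * suc K            ∎
    where
      open ≡-Reasoning
      step : ∀ x y → x * y + x ≡ x * suc y
      step = solve-∀

  lowerBound≤ : ∀ K → lowerBound n m (3 + K) ≤ suc (vertices K)
  lowerBound≤ K rewrite vertices≡ K with n % 2
  ... | zero  = ≤-reflexive (rearrange (5 * (n / 2)) (m * K))
    where rearrange : ∀ x y → x + y + 1 ≡ suc (x + 0 + y)
          rearrange = solve-∀
  ... | suc r = begin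
    5 * ((n ∸ 1) / 2) + m * K + 2   ≤⟨ +-monoˡ-≤ 2 (+-monoˡ-≤ (m * K) (*-monoʳ-≤ 5 (/-mono-≤ (m∸n≤m n 1) ≤-refl))) ⟩
    5 * (n / 2) + m * K + 2         ≤⟨ ≤-reflexive (rearrange (5 * (n / 2)) (m * K)) ⟩
    suc (5 * (n / 2) + 1 + m * K)   ≤⟨ s≤s (+-monoˡ-≤ (m * K) (+-mono-≤ (≤-refl {5 * (n / 2)}) (s≤s z≤n))) ⟩
    suc (5 * (n / 2) + suc r + m * K) ∎
    where
      open ≤-Reasoning
      rearrange : ∀ x y → x + y + 2 ≡ suc (x + 1 + y)
      rearrange = solve-∀

  embedding : ∀ {N} K → N ≤ vertices K → Fin N ↣ Layers K
  embedding K N≤ = ↔⇒↣ (layers-enumeration K) ↣-∘ mk↣ (inject≤-injective N≤ N≤ _ _)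

lemma2 : (n m k : ℕ) → m ≤ n → 4 ≤ k →
         (N : ℕ) → GRProperty k n m N → lowerBound n m k ≤ N
-- With k = 3 + K: any N below the bound embeds into the K-layered colouring,
-- whose restriction refutes GRProperty.
lemma2 n m (suc (suc (suc K))) m≤n (s≤s (s≤s (s≤s (s≤s _)))) N gr =
  ≮⇒≥ λ N<bound → refutes-GRProperty (layered K) (embedding K (≤-pred (≤-trans N<bound (lowerBound≤ K)))) gr
  where open Construction n m m≤n
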